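{- For every proximity poset $S$, let $\sigma_S:\mathrm{P_U}\mathrm{P_L}(S)\to\mathrm{P_L}\mathrm{P_U}(S)$ be defined by $\mathcal U\,\sigma_S\,\mathcal V\iff\mathcal U\,(\prec_L)_U\,\mathcal V^*$. Then $\sigma$ is a distributive law of $\mathrm{P_L}$ over $\mathrm{P_U}$: it is a natural transformation $\mathrm{P_U}\circ\mathrm{P_L}\to\mathrm{P_L}\circ\mathrm{P_U}$ satisfying, with $T=\mathrm{P_U}$ and $K=\mathrm{P_L}$, the equations $K\varepsilon^T\circ\sigma=\varepsilon^T K$, $\varepsilon^K T\circ\sigma=T\varepsilon^K$, $K\sigma\circ\sigma K\circ T\nu^K=\nu^K T\circ\sigma$, and $\sigma T\circ T\sigma\circ\nu^T K=K\nu^T\circ\sigma$.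
   Context: Work constructively; $\mathrm{Fin}(S)$ = finitely enumerable subsets of $S$, $\mathrm{Fin}^+(A)$ = inhabited finitely enumerable subsets of $A$. Proximity poset: $(S,\le,\prec)$, $(S,\le)$ a poset and $\prec$ a relation with $\{b\mid b\prec a\}$ a rounded ideal (downward closed, inhabited, directed $I$ with $x\in I\iff\exists y\,(x\prec y\ \&\ y\in I)$) and $\{b\mid a\prec b\}$ a rounded upward closed set ($x\in U\iff\exists y\,(y\prec x\ \&\ y\in U)$) for each $a$. Approximable relations $(S,\prec)\to(S',\prec')$: $r\subseteq S\times S'$ with each $\{a\mid a\,r\,b\}$ a rounded ideal and each $\{b\mid a\,r\,b\}$ a rounded upward closed set. $\mathsf{PxPos}$: proximity posets, approximable relations, identity $\prec$, relational composition. For $r\subseteq X\times Y$: $A\,r_L\,B\iff\forall a\in A\,\exists b\in B\,(a\,r\,b)$, $A\,r_U\,B\iff\forall b\in B\,\exists a\in A\,(a\,r\,b)$. Comonad $\mathrm{P_L}$ on $\mathsf{PxPos}$: $\mathrm{P_L}(S)=((\mathrm{Fin}(S),\le_L),\prec_L)$ (poset reflection of $\le_L$), $\mathrm{P_L}(r)=r_L$, counit $A\,\varepsilon^L_S\,a\iff A\prec_L\{a\}$, comultiplication $A\,\nu^L_S\,\mathcal U\iff A\prec_L\bigcup\mathcal U$. Comonad $\mathrm{P_U}$: same with $U$ in place of $L$ (counit $\varepsilon^U$, comultiplication $\nu^U$). For $\mathcal U\in\mathrm{Fin}(\mathrm{Fin}(S))$ define $\mathcal U^*$ inductively: $\emptyset^*=\{\emptyset\}$,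 $(\mathcal U\cup\{A\})^*=\{B\cup C\mid B\in\mathcal U^*,\ C\in\mathrm{Fin}^+(A)\}$. In the equations, $\varepsilon^K,\nu^K$ are the counit and comultiplication of $K$, and likewise for $T$; whiskering $FK\!$, $K\varepsilon^T$ etc. has the usual meaning. -}

module Defs where

open import Level using (0ℓ)
open import Data.List using (List; []; _∷_; _++_; concat; [_])
open import Data.List.Membership.Propositional using (_∈_)
open import Data.Product using (Σ; ∃; _×_; _,_)
open import Function.Bundles using (_⇔_)
open import Relation.Binary.Core using (Rel)
open import Relation.Binary.PropositionalEquality using (_≡_)
open import Relation.Binary.Structures using (IsPartialOrder)

-- Raw data of a proximity poset: carrier, order ≤, proximity ≺.
-- (The operations P_L, P_U, ε, ν, σ only use this raw data.)

record PxStr : Set₁ where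
  field
    Carrier : Set
    _≤_     : Carrier → Carrier → Set
    _≺_     : Carrier → Carrier → Set

module _ (S : PxStr) where
  open PxStr S

  record RoundedIdeal (I : Carrier → Set) : Set where
    field
      downClosed : ∀ {x y} → x ≤ y → I y → I x
      inhabited  : ∃ λ x → I x
      directed   : ∀ {x y} → I x → I y → ∃ λ z → I z × x ≤ z × y ≤ z
      rounded    : ∀ x → I x ⇔ (∃ λ y → x ≺ y × I y)

  record RoundedUpper (U : Carrier → Set) : Set where
    field
      upClosed : ∀ {x y} → x ≤ y → U x → U y
      rounded  : ∀ x → U x ⇔ (∃ λ y → y ≺ x × U y)

record ProximityPoset : Set₁ where
  field
    str            : PxStr
  open PxStr str public
  field
    _≈_            : Rel Carrier 0ℓ
    isPartialOrder : IsPartialOrder _≈_ _≤_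
    below-ideal    : ∀ a → RoundedIdeal str (λ b → b ≺ a)
    above-upper    : ∀ a → RoundedUpper str (λ b → a ≺ b)

PRel : PxStr → PxStr → Set₁
PRel S S' = PxStr.Carrier S → PxStr.Carrier S' → Set

record IsApproximable (S S' : PxStr) (r : PRel S S') : Set where
  field
    ideal : ∀ b → RoundedIdeal S  (λ a → r a b)
    upper : ∀ a → RoundedUpper S' (λ b → r a b)

infixr 9 _∘ʳ_
_∘ʳ_ : {X Y Z : Set} → (Y → Z → Set) → (X → Y → Set) → (X → Z → Set)
(s ∘ʳ r) a c = ∃ λ b → r a b × s b c

infix 4 _≐_
_≐_ : {X Y : Set} → (X → Y → Set) → (X → Y → Set) → Set
r ≐ s = ∀ a b → r a b ⇔ s a b

-- Finitely enumerable subsets are represented by lists; lifted relations.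

_ᴸ : {X Y : Set} → (X → Y → Set) → (List X → List Y → Set)
(r ᴸ) A B = ∀ {a} → a ∈ A → ∃ λ b → b ∈ B × r a b

_ᵁ : {X Y : Set} → (X → Y → Set) → (List X → List Y → Set)
(r ᵁ) A B = ∀ {b} → b ∈ B → ∃ λ a → a ∈ A × r a b

-- P_L(S) = ((Fin S, ≤_L), ≺_L)   (≤_L a preorder; its poset reflection
-- identifies mutually ≤_L-related lists, which no relation here can see)
PL : PxStr → PxStr
PL S = record { Carrier = List Carrier ; _≤_ = _≤_ ᴸ ; _≺_ = _≺_ ᴸ }
  where open PxStr S

PU : PxStr → PxStr
PU S = record { Carrier = List Carrier ; _≤_ = _≤_ ᵁ ; _≺_ = _≺_ ᵁ }
  where open PxStr S

εL : (S : PxStr) → PRel (PL S) S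
εL S A a = (PxStr._≺_ S ᴸ) A [ a ]

νL : (S : PxStr) → PRel (PL S) (PL (PL S))
νL S A 𝒰 = (PxStr._≺_ S ᴸ) A (concat 𝒰)

εU : (S : PxStr) → PRel (PU S) S
εU S A a = (PxStr._≺_ S ᵁ) A [ a ]

νU : (S : PxStr) → PRel (PU S) (PU (PU S))
νU S A 𝒰 = (PxStr._≺_ S ᵁ) A (concat 𝒰)

-- 𝒰* for 𝒰 ∈ Fin(Fin(S)), as a predicate on Fin(S):
--   ∅* = {∅},  (𝒰 ∪ {A})* = {B ∪ C | B ∈ 𝒰*, C ∈ Fin⁺(A)}
-- where C ∈ Fin⁺(A) means C is inhabited and every element of C is in A.

Star : {X : Set} → List (List X) → List X → Set
Star []      D = D ≡ []
Star (A ∷ 𝒰) D =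
  ∃ λ B → ∃ λ C → Star 𝒰 B × (∃ λ c → c ∈ C) × (∀ {c} → c ∈ C → c ∈ A)
        × D ≡ B ++ C

σ : (S : PxStr) → PRel (PU (PL S)) (PL (PU S))
σ S 𝒰 𝒱 = ∀ {B} → Star 𝒱 B → ∃ λ A → A ∈ 𝒰 × (PxStr._≺_ S ᴸ) A B

-- Read 𝒰 ∈ P_U P_L(S) as the join of meets ⋁_{A ∈ 𝒰} ⋀ A and 𝒱 ∈ P_L P_U(S) as the meet of
-- joins ⋀_{V ∈ 𝒱} ⋁ V.  Replacing 𝒱* by the set of all transversals of 𝒱 (its upward closure)
-- turns σ into the relation σ[ ≺ ], which makes sense for any relation R in place of ≺.
-- Precomposing σ with (r_L)_U or postcomposing it with (r_U)_L, for r approximable, both give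
-- σ[ r ]; this yields naturality and, with r = ≺, the roundedness of σ, from which the four
-- equations follow by short computations with singletons and concatenations.  Only the factorisation of σ[ r ] through (r_U)_L is
-- not a direct finite choice: each element w of each 𝒲-slot is replaced by some v with v r w,
-- taken as a common upper bound, in the directed ideal {v | v r w}, of the witnesses required
-- by the finitely many minimal transversals.

module Submission where

open import Defs
open import Data.Empty using (⊥; ⊥-elim)
open import Data.List using (List; []; _∷_; _++_; concat; [_]; map; cartesianProductWith)
open import Data.List.Properties using (concat-map-[_]; ++-identityʳ)
open import Data.List.Relation.Unary.Any using (here; there)
open import Data.List.Membership.Propositional using (_∈_)
open import Data.List.Membership.Propositional.Properties
  using (∈-++⁺ˡ; ∈-++⁺ʳ; ∈-++⁻; ∈-map⁺; ∈-map⁻; ∈-concat⁺′; ∈-concat⁻′;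
         ∈-cartesianProductWith⁺; ∈-cartesianProductWith⁻)
open import Data.List.Relation.Binary.Subset.Propositional using (_⊆_)
open import Data.Product using (_×_; ∃; _,_)
open import Data.Sum using (_⊎_; inj₁; inj₂; [_,_]′)
open import Function.Base using (_∘_; id)
open import Function.Bundles using (_⇔_; mk⇔; Equivalence)
open import Function.Properties.Equivalence using () renaming (sym to ⇔-sym; trans to ⇔-trans)
open import Relation.Binary.PropositionalEquality using (refl; sym; subst)
open import Relation.Binary.Structures using (IsPartialOrder)

open Equivalence using (to; from)

private variable
  X Y Z : Set

finite-choice : {K : Set} {P : Y → Set} {R : K → Y → Set} (ks : List K) →
  (∀ {k} → k ∈ ks → ∃ λ y → P y × R k y) →
  ∃ λ ys → (∀ {y} → y ∈ ys → P y) × (R ᴸ) ks ys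
finite-choice []       h = [] , (λ ()) , (λ ())
finite-choice {P = P} {R} (k ∷ ks) h =
  let (y , py , rky) = h (here refl)
      (ys , pys , rys) = finite-choice ks (h ∘ there)
  in y ∷ ys , P-all py pys , R-some rky rys
  where
  P-all : ∀ {y ys} → P y → (∀ {z} → z ∈ ys → P z) → ∀ {z} → z ∈ y ∷ ys → P z
  P-all py pys (here refl) = py
  P-all py pys (there q)   = pys q
  R-some : ∀ {y ys} → R k y → (R ᴸ) ks ys → (R ᴸ) (k ∷ ks) (y ∷ ys)
  R-some rky rys (here refl) = _ , here refl , rky
  R-some rky rys (there q)   = let (z , z∈ , rz) = rys q in z , there z∈ , rz

ᴸ-⊆ʳ : {R : X → Y → Set} {A : List X} {B C : List Y} → (R ᴸ) A B → B ⊆ C → (R ᴸ) A C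
ᴸ-⊆ʳ AB B⊆C a∈ = let (b , b∈ , rab) = AB a∈ in b , B⊆C b∈ , rab

ᴸ-∘ : {R : X → Y → Set} {Q : Y → Z → Set} {P : X → Z → Set} →
      (∀ {a b c} → R a b → Q b c → P a c) →
      ∀ {A B C} → (R ᴸ) A B → (Q ᴸ) B C → (P ᴸ) A C
ᴸ-∘ comp AB BC a∈ =
  let (b , b∈ , rab) = AB a∈ ; (c , c∈ , qbc) = BC b∈ in c , c∈ , comp rab qbc

ᴸ-factor : {R : X → Y → Set} {Q : Y → Z → Set} {P : X → Z → Set} →
           (∀ {a c} → P a c → ∃ λ b → R a b × Q b c) →
           ∀ {A C} → (P ᴸ) A C → ∃ λ B → (R ᴸ) A B × (Q ᴸ) B C
ᴸ-factor {Q = Q} factor {A} {C} AC =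
  let (B , BC , AB) = finite-choice {P = λ b → ∃ λ c → c ∈ C × Q b c} A
        (λ a∈ → let (c , c∈ , pac) = AC a∈ ; (b , rab , qbc) = factor pac
                in b , (c , c∈ , qbc) , rab)
  in B , AB , BC

ᴸ-concatˡ : {R : X → Y → Set} {𝒜 : List (List X)} {C : List Y} →
            (∀ {A} → A ∈ 𝒜 → (R ᴸ) A C) → (R ᴸ) (concat 𝒜) C
ᴸ-concatˡ {𝒜 = 𝒜} AC a∈ = let (A , a∈A , A∈) = ∈-concat⁻′ 𝒜 a∈ in AC A∈ a∈A

ᴸ-mapʳ : {R : X → Y → Set} {f : Z → Y} {A : List X} {B : List Z} →
         (R ᴸ) A (map f B) ⇔ ((λ a b → R a (f b)) ᴸ) A B
ᴸ-mapʳ {f = f} = mk⇔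
  (λ AfB {a} a∈ → unmap (AfB a∈))
  (λ AB {a} a∈ → let (b , b∈ , r) = AB a∈ in f b , ∈-map⁺ f b∈ , r)
  where
  unmap : ∀ {P : _ → Set} {B} → (∃ λ y → y ∈ map f B × P y) → ∃ λ b → b ∈ B × P (f b)
  unmap (y , y∈ , r) with ∈-map⁻ f y∈
  ... | b , b∈ , refl = b , b∈ , r

ᵁ-∷ : {R : X → Y → Set} {a : X} {b : Y} {A : List X} {B : List Y} →
      R a b → (R ᵁ) A B → (R ᵁ) (a ∷ A) (b ∷ B)
ᵁ-∷ rab AB (here refl) = _ , here refl , rab
ᵁ-∷ rab AB (there p)   = let (a , a∈ , r) = AB p in a , there a∈ , r

ᵁ-[-] : {R : X → Y → Set} {A : List X} {b : Y} → (R ᵁ) A [ b ] ⇔ (∃ λ a → a ∈ A × R a b)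
ᵁ-[-] = mk⇔ (λ h → h (here refl)) (λ { p (here refl) → p })

module _ {X : Set} where

  Transversal : List (List X) → List X → Set
  Transversal 𝒱 B = ((λ V v → v ∈ V) ᴸ) 𝒱 B

  singletons : List X → List (List X)
  singletons = map [_]

  transversal-∷ : ∀ {M 𝒱 B s} → s ∈ B → s ∈ M → Transversal 𝒱 B → Transversal (M ∷ 𝒱) B
  transversal-∷ s∈B s∈M h (here refl) = _ , s∈B , s∈M
  transversal-∷ s∈B s∈M h (there p)   = h p

  transversal-head-⊆ : ∀ {M M′ 𝒱 B} → M′ ⊆ M → Transversal (M′ ∷ 𝒱) B → Transversal (M ∷ 𝒱) B
  transversal-head-⊆ M′⊆M h with h (here refl)
  ... | b , b∈B , b∈M′ = transversal-∷ b∈B (M′⊆M b∈M′) (λ p → h (there p))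

  transversal-⊆ : ∀ {𝒱 B C} → B ⊆ C → Transversal 𝒱 B → Transversal 𝒱 C
  transversal-⊆ B⊆C h = ᴸ-⊆ʳ h B⊆C

  transversal-singletons : ∀ {A T} → Transversal (singletons A) T ⇔ A ⊆ T
  transversal-singletons {A} {T} = mk⇔ to′ from′
    where
    to′ : Transversal (singletons A) T → A ⊆ T
    to′ h a∈ with h (∈-map⁺ [_] a∈)
    ... | _ , t∈ , here refl = t∈
    from′ : A ⊆ T → Transversal (singletons A) T
    from′ A⊆T V∈ with ∈-map⁻ [_] V∈
    ... | a , a∈ , refl = a , A⊆T a∈ , here refl

  star⇒transversal : ∀ 𝒱 {B} → Star 𝒱 B → Transversal 𝒱 B
  star⇒transversal (A ∷ 𝒱) (B , C , ⋆B , (c , c∈C) , C⊆A , refl) (here refl) =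
    c , ∈-++⁺ʳ B c∈C , C⊆A c∈C
  star⇒transversal (A ∷ 𝒱) (B , C , ⋆B , _ , _ , refl) (there p) =
    let (v , v∈B , v∈V) = star⇒transversal 𝒱 ⋆B p in v , ∈-++⁺ˡ v∈B , v∈V

  transversal⇒star : ∀ 𝒱 {B} → Transversal 𝒱 B → ∃ λ B′ → Star 𝒱 B′ × B′ ⊆ B
  transversal⇒star []      h = [] , refl , λ ()
  transversal⇒star (A ∷ 𝒱) h =
    let (v , v∈B , v∈A) = h (here refl)
        (B′ , ⋆B′ , B′⊆B) = transversal⇒star 𝒱 (h ∘ there)
    in B′ ++ [ v ] , (B′ , [ v ] , ⋆B′ , (v , here refl) , (λ { (here refl) → v∈A }) , refl)
     , λ p → [ B′⊆B , (λ { (here refl) → v∈B }) ]′ (∈-++⁻ B′ p)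

  -- Every transversal contains one of these finitely many; finite-choice and ideal-common-bound
  -- can range over them but not over all transversals.
  choices : List (List X) → List (List X)
  choices []      = [ [] ]
  choices (V ∷ 𝒱) = cartesianProductWith _∷_ V (choices 𝒱)

  choice⇒transversal : ∀ 𝒱 {T} → T ∈ choices 𝒱 → Transversal 𝒱 T
  choice⇒transversal (V ∷ 𝒱) T∈ with ∈-cartesianProductWith⁻ _∷_ V (choices 𝒱) T∈
  ... | v , T , v∈V , T∈′ , refl =
    transversal-∷ (here refl) v∈V (transversal-⊆ there (choice⇒transversal 𝒱 T∈′))

  transversal⇒choice : ∀ 𝒱 {B} → Transversal 𝒱 B → ∃ λ T → T ∈ choices 𝒱 × T ⊆ B
  transversal⇒choice []      h = [] , here refl , λ ()
  transversal⇒choice (V ∷ 𝒱) h =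
    let (v , v∈B , v∈V) = h (here refl)
        (T , T∈ , T⊆B) = transversal⇒choice 𝒱 (h ∘ there)
    in v ∷ T , ∈-cartesianProductWith⁺ _∷_ v∈V T∈ , λ { (here refl) → v∈B ; (there p) → T⊆B p }

σ[_] : (X → Y → Set) → List (List X) → List (List Y) → Set
σ[ R ] 𝒰 𝒱 = ∀ {B} → Transversal 𝒱 B → ∃ λ A → A ∈ 𝒰 × (R ᴸ) A B

σ⇔σ[≺] : (S : PxStr) → ∀ {𝒰} 𝒱 → σ S 𝒰 𝒱 ⇔ σ[ PxStr._≺_ S ] 𝒰 𝒱
σ⇔σ[≺] S {𝒰} 𝒱 = mk⇔ to′ from′
  where
  to′ : σ S 𝒰 𝒱 → σ[ PxStr._≺_ S ] 𝒰 𝒱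
  to′ s h = let (B′ , ⋆B′ , B′⊆B) = transversal⇒star 𝒱 h ; (A , A∈ , AB′) = s ⋆B′
            in A , A∈ , ᴸ-⊆ʳ AB′ B′⊆B
  from′ : σ[ PxStr._≺_ S ] 𝒰 𝒱 → σ S 𝒰 𝒱
  from′ s ⋆B = s (star⇒transversal 𝒱 ⋆B)

σ[]-choices : {R : X → Y → Set} {𝒰 : List (List X)} → ∀ 𝒱 →
  (∀ {T} → T ∈ choices 𝒱 → ∃ λ A → A ∈ 𝒰 × (R ᴸ) A T) → σ[ R ] 𝒰 𝒱
σ[]-choices 𝒱 s h =
  let (T , T∈ , T⊆B) = transversal⇒choice 𝒱 h ; (A , A∈ , AT) = s T∈ in A , A∈ , ᴸ-⊆ʳ AT T⊆B

σ[]-precomp : {R : X → Y → Set} {Q : Y → Z → Set} {P : X → Z → Set} →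
  (∀ {a b c} → R a b → Q b c → P a c) →
  ∀ {𝒰 𝒰′ 𝒲} → ((R ᴸ) ᵁ) 𝒰 𝒰′ → σ[ Q ] 𝒰′ 𝒲 → σ[ P ] 𝒰 𝒲
σ[]-precomp comp 𝒰𝒰′ s h =
  let (A′ , A′∈ , A′B) = s h ; (A , A∈ , AA′) = 𝒰𝒰′ A′∈ in A , A∈ , ᴸ-∘ comp AA′ A′B

σ[]-postcomp : {Q : X → Y → Set} {R : Y → Z → Set} {P : X → Z → Set} →
  (∀ {a b c} → Q a b → R b c → P a c) →
  ∀ {𝒰 𝒱 𝒲} → σ[ Q ] 𝒰 𝒱 → ((R ᵁ) ᴸ) 𝒱 𝒲 → σ[ P ] 𝒰 𝒲
σ[]-postcomp {R = R} comp {𝒱 = 𝒱} s 𝒱𝒲 {T} h =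
  let (S , ST , hS) = finite-choice {P = λ s → ∃ λ t → t ∈ T × R s t} 𝒱
        (λ V∈ → let (W , W∈ , VW) = 𝒱𝒲 V∈ ; (t , t∈T , t∈W) = h W∈
                    (v , v∈V , rvt) = VW t∈W
                in v , (t , t∈T , rvt) , v∈V)
      (A , A∈ , AS) = s hS
  in A , A∈ , ᴸ-∘ comp AS ST

σ[]-factorᴸᵁ : {R : X → Y → Set} {Q : Y → Z → Set} {P : X → Z → Set} →
  (∀ {a c} → P a c → ∃ λ b → R a b × Q b c) →
  ∀ {𝒰} 𝒲 → σ[ P ] 𝒰 𝒲 → ∃ λ 𝒰′ → ((R ᴸ) ᵁ) 𝒰 𝒰′ × σ[ Q ] 𝒰′ 𝒲
σ[]-factorᴸᵁ {R = R} {Q} factor {𝒰} 𝒲 s =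
  let (𝒰′ , 𝒰𝒰′ , 𝒰′𝒲) = finite-choice {P = λ A′ → ∃ λ A → A ∈ 𝒰 × (R ᴸ) A A′}
        {R = λ T A′ → (Q ᴸ) A′ T} (choices 𝒲)
        (λ T∈ → let (A , A∈ , AT) = s (choice⇒transversal 𝒲 T∈)
                    (A′ , AA′ , A′T) = ᴸ-factor factor AT
                in A′ , (A , A∈ , AA′) , A′T)
  in 𝒰′ , 𝒰𝒰′ , σ[]-choices 𝒲 𝒰′𝒲

σ[]-product : {R : X → Y → Set} {𝒰₁ 𝒰₂ : List (List X)} {𝒱 : List (List Y)} →
  σ[ R ] 𝒰₁ 𝒱 → σ[ R ] 𝒰₂ 𝒱 → σ[ R ] (cartesianProductWith _++_ 𝒰₁ 𝒰₂) 𝒱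
σ[]-product s₁ s₂ h =
  let (A₁ , A₁∈ , A₁B) = s₁ h ; (A₂ , A₂∈ , A₂B) = s₂ h
  in A₁ ++ A₂ , ∈-cartesianProductWith⁺ _++_ A₁∈ A₂∈ , λ a∈ → [ A₁B , A₂B ]′ (∈-++⁻ A₁ a∈)

⊆⇒ᴸ : {R : X → X → Set} → (∀ {a} → R a a) → ∀ {A B} → A ⊆ B → (R ᴸ) A B
⊆⇒ᴸ R-refl A⊆B a∈ = _ , A⊆B a∈ , R-refl

product-ᴸᵁ : {R : X → X → Set} → (∀ {a} → R a a) → ∀ 𝒰₁ 𝒰₂ →
  ((R ᴸ) ᵁ) 𝒰₁ (cartesianProductWith _++_ 𝒰₁ 𝒰₂) × ((R ᴸ) ᵁ) 𝒰₂ (cartesianProductWith _++_ 𝒰₁ 𝒰₂)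
product-ᴸᵁ {R = R} R-refl 𝒰₁ 𝒰₂ = left , right
  where
  left : ((R ᴸ) ᵁ) 𝒰₁ (cartesianProductWith _++_ 𝒰₁ 𝒰₂)
  left p with ∈-cartesianProductWith⁻ _++_ 𝒰₁ 𝒰₂ p
  ... | A₁ , A₂ , A₁∈ , A₂∈ , refl = A₁ , A₁∈ , ⊆⇒ᴸ {R = R} R-refl ∈-++⁺ˡ
  right : ((R ᴸ) ᵁ) 𝒰₂ (cartesianProductWith _++_ 𝒰₁ 𝒰₂)
  right p with ∈-cartesianProductWith⁻ _++_ 𝒰₁ 𝒰₂ p
  ... | A₁ , A₂ , A₁∈ , A₂∈ , refl = A₂ , A₂∈ , ⊆⇒ᴸ {R = R} R-refl (∈-++⁺ʳ A₁)

σ[]-singletons : {R : X → Y → Set} {𝒰 : List (List X)} {A : List Y} →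
  σ[ R ] 𝒰 (singletons A) ⇔ (∃ λ A′ → A′ ∈ 𝒰 × (R ᴸ) A′ A)
σ[]-singletons {R = R} {𝒰} {A} = mk⇔ to′ from′
  where
  to′ : σ[ R ] 𝒰 (singletons A) → ∃ λ A′ → A′ ∈ 𝒰 × (R ᴸ) A′ A
  to′ s = s (from transversal-singletons id)
  from′ : (∃ λ A′ → A′ ∈ 𝒰 × (R ᴸ) A′ A) → σ[ R ] 𝒰 (singletons A)
  from′ (A′ , A′∈ , A′A) h = A′ , A′∈ , ᴸ-⊆ʳ A′A (to transversal-singletons h)

σ[]-[-] : {R : X → Y → Set} {𝒰 : List (List X)} {B : List Y} →
  σ[ R ] 𝒰 [ B ] ⇔ ((λ A b → (R ᴸ) A [ b ]) ᵁ) 𝒰 B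
σ[]-[-] {R = R} {𝒰} {B} = mk⇔ to′ from′
  where
  to′ : σ[ R ] 𝒰 [ B ] → ((λ A b → (R ᴸ) A [ b ]) ᵁ) 𝒰 B
  to′ s {b} b∈ = s (transversal-∷ (here refl) b∈ (λ ()))
  from′ : ((λ A b → (R ᴸ) A [ b ]) ᵁ) 𝒰 B → σ[ R ] 𝒰 [ B ]
  from′ h hT = let (t , t∈T , t∈B) = hT (here refl) ; (A , A∈ , At) = h t∈B
               in A , A∈ , ᴸ-⊆ʳ At (λ { (here refl) → t∈T })

ᵁ⇒σ[]-singletons : {R : X → Y → Set} {V : List X} {W : List Y} {𝒵 : List (List Y)} →
  W ∈ 𝒵 → (R ᵁ) V W → σ[ R ] (singletons V) 𝒵
ᵁ⇒σ[]-singletons W∈ VW hT =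
  let (w , w∈T , w∈W) = hT W∈ ; (v , v∈V , rvw) = VW w∈W
  in [ v ] , ∈-map⁺ [_] v∈V , λ { (here refl) → w , w∈T , rvw }

σ[]-map-singletons : {R : X → Y → Set} {𝒰 : List (List X)} {𝒱 : List (List Y)} →
  σ[ R ] 𝒰 𝒱 → σ[ R ᴸ ] (map singletons 𝒰) (map singletons 𝒱)
σ[]-map-singletons {R = R} {𝒱 = 𝒱} s {ℭ} hℭ =
  let (S , S⊆ℭ , hS) = finite-choice {P = λ v → [ v ] ∈ ℭ} 𝒱
        (λ V∈ → singleton-hit (hℭ (∈-map⁺ singletons V∈)))
      (A , A∈ , AS) = s hS
  in singletons A , ∈-map⁺ singletons A∈ , lift AS S⊆ℭ
  where
  singleton-hit : ∀ {V} → (∃ λ C → C ∈ ℭ × C ∈ singletons V) → ∃ λ v → [ v ] ∈ ℭ × v ∈ V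
  singleton-hit (C , C∈ℭ , C∈) with ∈-map⁻ [_] C∈
  ... | v , v∈V , refl = v , C∈ℭ , v∈V
  lift : ∀ {A S} → (R ᴸ) A S → (∀ {s} → s ∈ S → [ s ] ∈ ℭ) → ((R ᴸ) ᴸ) (singletons A) ℭ
  lift AS S⊆ℭ p with ∈-map⁻ [_] p
  ... | a , a∈ , refl =
    let (s , s∈ , ras) = AS a∈ in [ s ] , S⊆ℭ s∈ , λ { (here refl) → s , here refl , ras }

σ[ᵁ]-transversal : {R : X → Y → Set} {𝔅 : List (List (List X))} {ℨ : List (List (List Y))} →
  σ[ R ᵁ ] 𝔅 ℨ → ∀ {T} → Transversal (map concat ℨ) T →
  ∃ λ 𝒷 → 𝒷 ∈ 𝔅 × ∃ λ S → Transversal 𝒷 S × (R ᴸ) S T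
σ[ᵁ]-transversal {R = R} {ℨ = ℨ} s {T} hT =
  let (ℭ , ℭ-meets-T , hℭ) = finite-choice {P = λ W → ∃ λ t → t ∈ T × t ∈ W} {R = λ 𝒵 W → W ∈ 𝒵} ℨ
        (λ {𝒵} 𝒵∈ → let (t , t∈T , t∈c) = hT (∈-map⁺ concat 𝒵∈)
                        (W , t∈W , W∈𝒵) = ∈-concat⁻′ 𝒵 t∈c
                    in W , (t , t∈T , t∈W) , W∈𝒵)
      (𝒷 , 𝒷∈ , 𝒷ℭ) = s hℭ
      (S , ST , hS) = finite-choice {P = λ v → ∃ λ t → t ∈ T × R v t} {R = λ V v → v ∈ V} 𝒷
        (λ V∈ → let (W , W∈ℭ , VW) = 𝒷ℭ V∈ ; (t , t∈T , t∈W) = ℭ-meets-T W∈ℭ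
                    (v , v∈V , rvt) = VW t∈W
                in v , (t , t∈T , rvt) , v∈V)
  in 𝒷 , 𝒷∈ , S , hS , ST

ᵁᴸ-concat⇒σ[ᵁ]-[-] : {R : X → Y → Set} {𝒱 : List (List X)} {ℨ : List (List (List Y))} →
  ((R ᵁ) ᴸ) 𝒱 (map concat ℨ) → σ[ R ᵁ ] [ 𝒱 ] ℨ
ᵁᴸ-concat⇒σ[ᵁ]-[-] {R = R} {ℨ = ℨ} 𝒱ℨ {ℭ} hℭ = _ , here refl , λ V∈ → below (𝒱ℨ V∈)
  where
  below : ∀ {V} → (∃ λ W → W ∈ map concat ℨ × (R ᵁ) V W) → ∃ λ C → C ∈ ℭ × (R ᵁ) V C
  below (W , W∈ , VW) with ∈-map⁻ concat W∈
  ... | 𝒵 , 𝒵∈ , refl =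
    let (C , C∈ℭ , C∈𝒵) = hℭ 𝒵∈ in C , C∈ℭ , λ c∈C → VW (∈-concat⁺′ c∈C C∈𝒵)

ideal-common-bound : {S : PxStr} {I : PxStr.Carrier S → Set} → RoundedIdeal S I →
  {K : Set} (P : K → PxStr.Carrier S → Set) → (∀ k {z z′} → PxStr._≤_ S z z′ → P k z → P k z′) →
  ∀ ks → (∀ {k} → k ∈ ks → ∃ λ z → I z × P k z) → ∃ λ z → I z × (∀ {k} → k ∈ ks → P k z)
ideal-common-bound I P mono []       h =
  let (z , z∈) = RoundedIdeal.inhabited I in z , z∈ , λ ()
ideal-common-bound I P mono (k ∷ ks) h =
  let (z₁ , z₁∈ , p₁) = h (here refl)
      (z₂ , z₂∈ , p₂) = ideal-common-bound I P mono ks (h ∘ there)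
      (z , z∈ , z₁≤z , z₂≤z) = RoundedIdeal.directed I z₁∈ z₂∈
  in z , z∈ , λ { (here refl) → mono k z₁≤z p₁ ; (there q) → mono _ z₂≤z (p₂ q) }

module ProximityProperties (S : ProximityPoset) where
  open ProximityPoset S

  ≤-refl : ∀ {a} → a ≤ a
  ≤-refl = IsPartialOrder.refl isPartialOrder

  ≺-trans : ∀ {a b c} → a ≺ b → b ≺ c → a ≺ c
  ≺-trans {a} {b} {c} a≺b b≺c = from (RoundedIdeal.rounded (below-ideal c) a) (b , a≺b , b≺c)

  ≤-≺-trans : ∀ {a b c} → a ≤ b → b ≺ c → a ≺ c
  ≤-≺-trans {c = c} = RoundedIdeal.downClosed (below-ideal c)

  ≺-≤-trans : ∀ {a b c} → a ≺ b → b ≤ c → a ≺ c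
  ≺-≤-trans {a} a≺b b≤c = RoundedUpper.upClosed (above-upper a) b≤c a≺b

module Replacement (S : ProximityPoset) {Y : Set} (r : ProximityPoset.Carrier S → Y → Set)
  (ideal : ∀ w → RoundedIdeal (ProximityPoset.str S) (λ a → r a w)) where
  open ProximityPoset S
  open ProximityProperties S

  Near : Carrier → List Carrier → List Y → Set
  Near a B C = (∃ λ b → b ∈ B × a ≺ b) ⊎ (∃ λ c → c ∈ C × r a c)

  -- Invariant of the conversion of σ[ r ] 𝒰 𝒲: the slots 𝒫 are already converted to X, the
  -- slots 𝒬 of 𝒲 are still in Y.
  Mixed : List (List Carrier) → List (List Carrier) → List (List Y) → Set
  Mixed 𝒰 𝒫 𝒬 = ∀ {B C} → Transversal 𝒫 B → Transversal 𝒬 C →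
    ∃ λ A → A ∈ 𝒰 × (∀ {a} → a ∈ A → Near a B C)

  near-⊆ : ∀ {a B B′ C C′} → B ⊆ B′ → C ⊆ C′ → Near a B C → Near a B′ C′
  near-⊆ B⊆B′ C⊆C′ (inj₁ (b , b∈ , a≺b)) = inj₁ (b , B⊆B′ b∈ , a≺b)
  near-⊆ B⊆B′ C⊆C′ (inj₂ (c , c∈ , rac)) = inj₂ (c , C⊆C′ c∈ , rac)

  near-≤ : ∀ {a v v′ B C} → v ≤ v′ → Near a (v ∷ B) C → Near a (v′ ∷ B) C
  near-≤ v≤v′ (inj₁ (_ , here refl , a≺v)) = inj₁ (_ , here refl , ≺-≤-trans a≺v v≤v′)
  near-≤ v≤v′ (inj₁ (b , there b∈ , a≺b)) = inj₁ (b , there b∈ , a≺b)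
  near-≤ v≤v′ (inj₂ near)                  = inj₂ near

  near-shift : ∀ {a w B C} → Near a B (w ∷ C) → ∃ λ v → r v w × Near a (v ∷ B) C
  near-shift {w = w} (inj₁ (b , b∈ , a≺b)) =
    let (v , rvw) = RoundedIdeal.inhabited (ideal w) in v , rvw , inj₁ (b , there b∈ , a≺b)
  near-shift {a} {w} (inj₂ (_ , here refl , raw)) =
    let (v , a≺v , rvw) = to (RoundedIdeal.rounded (ideal w) a) raw
    in v , rvw , inj₁ (v , here refl , a≺v)
  near-shift {w = w} (inj₂ (c , there c∈ , rac)) =
    let (v , rvw) = RoundedIdeal.inhabited (ideal w) in v , rvw , inj₂ (c , c∈ , rac)

  near-[] : ∀ {a B} → Near a B [] → ∃ λ b → b ∈ B × a ≺ b
  near-[] (inj₁ near) = near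

  mixed-split : ∀ {𝒰 v V 𝒫 𝒬} →
    Mixed 𝒰 ([ v ] ∷ 𝒫) 𝒬 → Mixed 𝒰 (V ∷ 𝒫) 𝒬 → Mixed 𝒰 ((v ∷ V) ∷ 𝒫) 𝒬
  mixed-split m₁ m₂ hB hC with hB (here refl)
  ... | b , b∈ , here refl = m₁ (transversal-∷ b∈ (here refl) (λ p → hB (there p))) hC
  ... | b , b∈ , there b∈V = m₂ (transversal-∷ b∈ b∈V (λ p → hB (there p))) hC

  -- For each pair of minimal transversals the roundedness of {v | v r w} supplies a suitable v
  -- for each a that needed w; directedness then bounds these finitely many candidates.
  mixed-replace : ∀ {𝒰} 𝒫 𝒬 {w} → Mixed 𝒰 𝒫 ([ w ] ∷ 𝒬) → ∃ λ v → r v w × Mixed 𝒰 ([ v ] ∷ 𝒫) 𝒬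
  mixed-replace {𝒰} 𝒫 𝒬 {w} m =
    let (v , rvw , good) =
          ideal-common-bound (ideal w) (λ B v → ∀ {C} → C ∈ choices 𝒬 → Good B C v)
            (λ B v≤v′ good C∈ → Good-≤ v≤v′ (good C∈)) (choices 𝒫)
            (λ B∈ → ideal-common-bound (ideal w) (Good _) (λ C → Good-≤) (choices 𝒬) (good-choices B∈))
    in v , rvw , mixed-from-choices good
    where
    Good : List Carrier → List Y → Carrier → Set
    Good B C v = ∃ λ A → A ∈ 𝒰 × (∀ {a} → a ∈ A → Near a (v ∷ B) C)
    Good-≤ : ∀ {B C v v′} → v ≤ v′ → Good B C v → Good B C v′
    Good-≤ v≤v′ (A , A∈ , near) = A , A∈ , λ a∈ → near-≤ v≤v′ (near a∈)
    good-choices : ∀ {B C} → B ∈ choices 𝒫 → C ∈ choices 𝒬 → ∃ λ v → r v w × Good B C v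
    good-choices B∈ C∈ =
      let (A , A∈ , near) = m (choice⇒transversal 𝒫 B∈)
            (transversal-∷ (here refl) (here refl) (transversal-⊆ there (choice⇒transversal 𝒬 C∈)))
          (v , rvw , near′) = ideal-common-bound (ideal w) (λ a v → Near a (v ∷ _) _) (λ _ → near-≤) A
            (λ a∈ → near-shift (near a∈))
      in v , rvw , A , A∈ , near′
    mixed-from-choices : ∀ {v} → (∀ {B} → B ∈ choices 𝒫 → ∀ {C} → C ∈ choices 𝒬 → Good B C v) →
                         Mixed 𝒰 ([ v ] ∷ 𝒫) 𝒬
    mixed-from-choices good hB′ hC′ with hB′ (here refl)
    ... | _ , v∈B′ , here refl =
      let (B , B∈ , B⊆B′) = transversal⇒choice 𝒫 (λ p → hB′ (there p))
          (C , C∈ , C⊆C′) = transversal⇒choice 𝒬 hC′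
          (A , A∈ , near) = good B∈ C∈
      in A , A∈ , λ a∈ → near-⊆ (λ { (here refl) → v∈B′ ; (there p) → B⊆B′ p }) C⊆C′ (near a∈)

  mixed-convert-slot : ∀ {𝒰} 𝒫 𝒬 W → Mixed 𝒰 𝒫 (W ∷ 𝒬) →
    ∃ λ V → (r ᵁ) V W × Mixed 𝒰 (V ∷ 𝒫) 𝒬
  mixed-convert-slot 𝒫 𝒬 []      m = [] , (λ ()) , λ hB _ → ⊥-elim (no-transversal hB)
    where
    no-transversal : ∀ {B} → Transversal ([] ∷ 𝒫) B → ⊥
    no-transversal hB with hB (here refl)
    ... | _ , _ , ()
  mixed-convert-slot 𝒫 𝒬 (w ∷ W) m =
    let (v , rvw , m₁) = mixed-replace 𝒫 𝒬
          (λ hB hC → m hB (transversal-head-⊆ (λ { (here refl) → here refl }) hC))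
        (V , VW , m₂) = mixed-convert-slot 𝒫 𝒬 W (λ hB hC → m hB (transversal-head-⊆ there hC))
    in v ∷ V , ᵁ-∷ rvw VW , mixed-split m₁ m₂

  mixed-convert : ∀ {𝒰 𝒫 𝒲} 𝒬 → 𝒬 ⊆ 𝒲 → ((r ᵁ) ᴸ) 𝒫 𝒲 → Mixed 𝒰 𝒫 𝒬 →
                  ∃ λ 𝒱 → ((r ᵁ) ᴸ) 𝒱 𝒲 × Mixed 𝒰 𝒱 []
  mixed-convert []      _    𝒫𝒲 m = _ , 𝒫𝒲 , m
  mixed-convert {𝒫 = 𝒫} (W ∷ 𝒬) W𝒬⊆𝒲 𝒫𝒲 m =
    let (V , VW , m′) = mixed-convert-slot 𝒫 𝒬 W m
        V𝒫𝒲 : ((r ᵁ) ᴸ) (V ∷ 𝒫) _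
        V𝒫𝒲 = λ { (here refl) → W , W𝒬⊆𝒲 (here refl) , VW ; (there p) → 𝒫𝒲 p }
    in mixed-convert 𝒬 (W𝒬⊆𝒲 ∘ there) V𝒫𝒲 m′

  σ[]-factorᵁᴸ : ∀ {𝒰} 𝒲 → σ[ r ] 𝒰 𝒲 → ∃ λ 𝒱 → σ[ _≺_ ] 𝒰 𝒱 × ((r ᵁ) ᴸ) 𝒱 𝒲
  σ[]-factorᵁᴸ 𝒲 s =
    let (𝒱 , 𝒱𝒲 , m) = mixed-convert {𝒫 = []} 𝒲 id (λ ())
          (λ _ hC → let (A , A∈ , AC) = s hC in A , A∈ , λ a∈ → inj₂ (AC a∈))
    in 𝒱 , (λ hB → let (A , A∈ , near) = m hB (λ ()) in A , A∈ , λ a∈ → near-[] (near a∈)) , 𝒱𝒲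

σ∘ᴸᵁ⇔σ[] : (S T : PxStr) (r : PRel S T) → (∀ a → RoundedUpper T (r a)) →
  ∀ 𝒰 𝒲 → (σ T ∘ʳ ((r ᴸ) ᵁ)) 𝒰 𝒲 ⇔ σ[ r ] 𝒰 𝒲
σ∘ᴸᵁ⇔σ[] S T r upper 𝒰 𝒲 = mk⇔ to′ from′
  where
  open PxStr T using (_≺_)
  r-≺ : ∀ {a b c} → r a b → b ≺ c → r a c
  r-≺ {a} {b} {c} rab b≺c = from (RoundedUpper.rounded (upper a) c) (b , b≺c , rab)
  r-interpolate : ∀ {a c} → r a c → ∃ λ b → r a b × b ≺ c
  r-interpolate {a} {c} rac =
    let (b , b≺c , rab) = to (RoundedUpper.rounded (upper a) c) rac in b , rab , b≺c
  to′ : (σ T ∘ʳ ((r ᴸ) ᵁ)) 𝒰 𝒲 → σ[ r ] 𝒰 𝒲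
  to′ (𝒰′ , 𝒰𝒰′ , s) = σ[]-precomp r-≺ 𝒰𝒰′ (to (σ⇔σ[≺] T 𝒲) s)
  from′ : σ[ r ] 𝒰 𝒲 → (σ T ∘ʳ ((r ᴸ) ᵁ)) 𝒰 𝒲
  from′ s =
    let (𝒰′ , 𝒰𝒰′ , s′) = σ[]-factorᴸᵁ r-interpolate 𝒲 s in 𝒰′ , 𝒰𝒰′ , from (σ⇔σ[≺] T 𝒲) s′

ᵁᴸ∘σ⇔σ[] : (S : ProximityPoset) (r : ProximityPoset.Carrier S → Y → Set) →
  (∀ w → RoundedIdeal (ProximityPoset.str S) (λ a → r a w)) →
  ∀ 𝒰 𝒲 → (((r ᵁ) ᴸ) ∘ʳ σ (ProximityPoset.str S)) 𝒰 𝒲 ⇔ σ[ r ] 𝒰 𝒲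
ᵁᴸ∘σ⇔σ[] S r ideal 𝒰 𝒲 = mk⇔ to′ from′
  where
  open ProximityPoset S
  ≺-r : ∀ {a b c} → a ≺ b → r b c → r a c
  ≺-r {a} {b} {c} a≺b rbc = from (RoundedIdeal.rounded (ideal c) a) (b , a≺b , rbc)
  to′ : (((r ᵁ) ᴸ) ∘ʳ σ str) 𝒰 𝒲 → σ[ r ] 𝒰 𝒲
  to′ (𝒱 , s , 𝒱𝒲) = σ[]-postcomp ≺-r (to (σ⇔σ[≺] str 𝒱) s) 𝒱𝒲
  from′ : σ[ r ] 𝒰 𝒲 → (((r ᵁ) ᴸ) ∘ʳ σ str) 𝒰 𝒲
  from′ s =
    let (𝒱 , s′ , 𝒱𝒲) = Replacement.σ[]-factorᵁᴸ S r ideal 𝒲 s in 𝒱 , from (σ⇔σ[≺] str 𝒱) s′ , 𝒱𝒲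

σ-natural : (S S′ : ProximityPoset) → let X = ProximityPoset.str S in let Y = ProximityPoset.str S′ in
  (r : PRel X Y) → IsApproximable X Y r → (σ Y ∘ʳ ((r ᴸ) ᵁ)) ≐ (((r ᵁ) ᴸ) ∘ʳ σ X)
σ-natural S S′ r approx 𝒰 𝒲 = ⇔-trans
  (σ∘ᴸᵁ⇔σ[] (ProximityPoset.str S) (ProximityPoset.str S′) r (IsApproximable.upper approx) 𝒰 𝒲)
  (⇔-sym (ᵁᴸ∘σ⇔σ[] S r (IsApproximable.ideal approx) 𝒰 𝒲))

module _ (S : ProximityPoset) where
  open ProximityPoset S
  open ProximityProperties S

  private
    σ⇔ : ∀ {𝒰} 𝒱 → σ str 𝒰 𝒱 ⇔ σ[ _≺_ ] 𝒰 𝒱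
    σ⇔ = σ⇔σ[≺] str

    σ∘ᴸᵁ⇔ : ∀ 𝒰 𝒲 → (σ str ∘ʳ ((_≺_ ᴸ) ᵁ)) 𝒰 𝒲 ⇔ σ[ _≺_ ] 𝒰 𝒲
    σ∘ᴸᵁ⇔ = σ∘ᴸᵁ⇔σ[] str str _≺_ above-upper

    ᵁᴸ∘σ⇔ : ∀ 𝒰 𝒲 → (((_≺_ ᵁ) ᴸ) ∘ʳ σ str) 𝒰 𝒲 ⇔ σ[ _≺_ ] 𝒰 𝒲
    ᵁᴸ∘σ⇔ = ᵁᴸ∘σ⇔σ[] S _≺_ below-ideal

    ᵁᴸ∘σ⇔σ[]-map : {Z : Set} (f : Z → List Carrier) → ∀ 𝒰 C →
      (((λ V c → (_≺_ ᵁ) V (f c)) ᴸ) ∘ʳ σ str) 𝒰 C ⇔ σ[ _≺_ ] 𝒰 (map f C)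
    ᵁᴸ∘σ⇔σ[]-map f 𝒰 C = ⇔-trans (mk⇔ to′ from′) (ᵁᴸ∘σ⇔ 𝒰 (map f C))
      where
      to′ : (((λ V c → (_≺_ ᵁ) V (f c)) ᴸ) ∘ʳ σ str) 𝒰 C → (((_≺_ ᵁ) ᴸ) ∘ʳ σ str) 𝒰 (map f C)
      to′ (𝒱 , s , 𝒱C) = 𝒱 , s , from ᴸ-mapʳ 𝒱C
      from′ : (((_≺_ ᵁ) ᴸ) ∘ʳ σ str) 𝒰 (map f C) → (((λ V c → (_≺_ ᵁ) V (f c)) ᴸ) ∘ʳ σ str) 𝒰 C
      from′ (𝒱 , s , 𝒱C) = 𝒱 , s , to ᴸ-mapʳ 𝒱C

    ≺ᴸ-trans : ∀ {A B C} → (_≺_ ᴸ) A B → (_≺_ ᴸ) B C → (_≺_ ᴸ) A C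
    ≺ᴸ-trans = ᴸ-∘ ≺-trans

  σ-approximable : IsApproximable (PU (PL str)) (PL (PU str)) (σ str)
  σ-approximable = record { ideal = ideal ; upper = upper }
    where
    ideal : ∀ 𝒱 → RoundedIdeal (PU (PL str)) (λ 𝒰 → σ str 𝒰 𝒱)
    ideal 𝒱 = record
      { downClosed = λ 𝒰₁𝒰₂ s → from (σ⇔ 𝒱) (σ[]-precomp ≤-≺-trans 𝒰₁𝒰₂ (to (σ⇔ 𝒱) s))
      ; inhabited  = [ [] ] , from (σ⇔ 𝒱) (λ _ → [] , here refl , λ ())
      ; directed   = λ {𝒰₁} {𝒰₂} s₁ s₂ →
          cartesianProductWith _++_ 𝒰₁ 𝒰₂ , from (σ⇔ 𝒱) (σ[]-product (to (σ⇔ 𝒱) s₁) (to (σ⇔ 𝒱) s₂))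
          , product-ᴸᵁ ≤-refl 𝒰₁ 𝒰₂
      ; rounded    = λ 𝒰 → ⇔-trans (σ⇔ 𝒱) (⇔-sym (σ∘ᴸᵁ⇔ 𝒰 𝒱))
      }
    upper : ∀ 𝒰 → RoundedUpper (PL (PU str)) (λ 𝒱 → σ str 𝒰 𝒱)
    upper 𝒰 = record
      { upClosed = λ {𝒱₁} {𝒱₂} 𝒱₁𝒱₂ s → from (σ⇔ 𝒱₂) (σ[]-postcomp ≺-≤-trans (to (σ⇔ 𝒱₁) s) 𝒱₁𝒱₂)
      ; rounded  = λ 𝒱 → ⇔-trans (σ⇔ 𝒱) (⇔-trans (⇔-sym (ᵁᴸ∘σ⇔ 𝒰 𝒱)) ∃-swap)
      }
      where
      ∃-swap : ∀ {𝒱} → (((_≺_ ᵁ) ᴸ) ∘ʳ σ str) 𝒰 𝒱 ⇔ ∃ λ 𝒱′ → ((_≺_ ᵁ) ᴸ) 𝒱′ 𝒱 × σ str 𝒰 𝒱′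
      ∃-swap = mk⇔ (λ (𝒱′ , s , 𝒱′𝒱) → 𝒱′ , 𝒱′𝒱 , s) (λ (𝒱′ , 𝒱′𝒱 , s) → 𝒱′ , s , 𝒱′𝒱)

  εUᴸ∘σ≐εU : ((εU str ᴸ) ∘ʳ σ str) ≐ εU (PL str)
  εUᴸ∘σ≐εU 𝒰 A =
    ⇔-trans (ᵁᴸ∘σ⇔σ[]-map [_] 𝒰 A) (⇔-trans σ[]-singletons (⇔-sym ᵁ-[-]))

  εL∘σ≐εLᵁ : (εL (PU str) ∘ʳ σ str) ≐ (εL str ᵁ)
  εL∘σ≐εLᵁ 𝒰 B = ⇔-trans (ᵁᴸ∘σ⇔ 𝒰 [ B ]) σ[]-[-]

  σᴸ∘σ∘νLᵁ≐νL∘σ : ((σ str ᴸ) ∘ʳ σ (PL str) ∘ʳ (νL str ᵁ)) ≐ (νL (PU str) ∘ʳ σ str)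
  σᴸ∘σ∘νLᵁ≐νL∘σ 𝒰 ℨ = ⇔-trans (mk⇔ to′ from′) (⇔-sym (ᵁᴸ∘σ⇔ 𝒰 (concat ℨ)))
    where
    to′ : ((σ str ᴸ) ∘ʳ σ (PL str) ∘ʳ (νL str ᵁ)) 𝒰 ℨ → σ[ _≺_ ] 𝒰 (concat ℨ)
    to′ (𝔅 , (𝔄 , 𝒰𝔄 , 𝔄𝔅) , 𝔅ℨ) {T} hT =
      let (ℭ , ℭ≺T , hℭ) = finite-choice {P = λ C → (_≺_ ᴸ) C T} {R = λ 𝒷 C → C ∈ 𝒷} 𝔅
            (λ 𝒷∈ → let (𝒵 , 𝒵∈ , s) = 𝔅ℨ 𝒷∈
                        (B , B∈ , BT) = to (σ⇔ 𝒵) s (λ V∈ → hT (∈-concat⁺′ V∈ 𝒵∈))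
                    in B , BT , B∈)
          (𝒜 , 𝒜∈ , 𝒜ℭ) = to (σ⇔σ[≺] (PL str) 𝔅) 𝔄𝔅 hℭ
          (A , A∈ , A𝒜) = 𝒰𝔄 𝒜∈
          𝒜≺T : ∀ {A′} → A′ ∈ 𝒜 → (_≺_ ᴸ) A′ T
          𝒜≺T A′∈ = let (C , C∈ , A′C) = 𝒜ℭ A′∈ in ≺ᴸ-trans A′C (ℭ≺T C∈)
      in A , A∈ , ≺ᴸ-trans A𝒜 (ᴸ-concatˡ 𝒜≺T)
    νL-singletons : ∀ {𝒰′} → ((_≺_ ᴸ) ᵁ) 𝒰 𝒰′ → (νL str ᵁ) 𝒰 (map singletons 𝒰′)
    νL-singletons 𝒰𝒰′ p with ∈-map⁻ singletons p
    ... | A′ , A′∈ , refl =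
      let (A , A∈ , AA′) = 𝒰𝒰′ A′∈ in A , A∈ , subst ((_≺_ ᴸ) A) (sym (concat-map-[ A′ ])) AA′
    σ-singletons : ∀ {𝒱} → ((_≺_ ᵁ) ᴸ) 𝒱 (concat ℨ) → (σ str ᴸ) (map singletons 𝒱) ℨ
    σ-singletons 𝒱ℨ p with ∈-map⁻ singletons p
    ... | V , V∈ , refl =
      let (W , W∈ , VW) = 𝒱ℨ V∈ ; (𝒵 , W∈𝒵 , 𝒵∈) = ∈-concat⁻′ ℨ W∈
      in 𝒵 , 𝒵∈ , from (σ⇔ 𝒵) (ᵁ⇒σ[]-singletons W∈𝒵 VW)
    from′ : σ[ _≺_ ] 𝒰 (concat ℨ) → ((σ str ᴸ) ∘ʳ σ (PL str) ∘ʳ (νL str ᵁ)) 𝒰 ℨ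
    from′ s =
      let (𝒱 , s𝒱 , 𝒱ℨ) = from (ᵁᴸ∘σ⇔ 𝒰 (concat ℨ)) s
          (𝒰′ , 𝒰𝒰′ , s𝒰′) = from (σ∘ᴸᵁ⇔ 𝒰 𝒱) (to (σ⇔ 𝒱) s𝒱)
          s-singletons = from (σ⇔σ[≺] (PL str) (map singletons 𝒱)) (σ[]-map-singletons (to (σ⇔ 𝒱) s𝒰′))
      in map singletons 𝒱 , (map singletons 𝒰′ , νL-singletons 𝒰𝒰′ , s-singletons) , σ-singletons 𝒱ℨ

  σ∘σᵁ∘νU≐νUᴸ∘σ : (σ (PU str) ∘ʳ (σ str ᵁ) ∘ʳ νU (PL str)) ≐ ((νU str ᴸ) ∘ʳ σ str)
  σ∘σᵁ∘νU≐νUᴸ∘σ 𝒰 ℨ = ⇔-trans (mk⇔ to′ from′) (⇔-sym (ᵁᴸ∘σ⇔σ[]-map concat 𝒰 ℨ))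
    where
    to′ : (σ (PU str) ∘ʳ (σ str ᵁ) ∘ʳ νU (PL str)) 𝒰 ℨ → σ[ _≺_ ] 𝒰 (map concat ℨ)
    to′ (𝔅 , (𝔄 , 𝒰𝔄 , 𝔄𝔅) , 𝔅ℨ) hT =
      let (𝒷 , 𝒷∈ , S , hS , S≺T) = σ[ᵁ]-transversal (to (σ⇔σ[≺] (PU str) ℨ) 𝔅ℨ) hT
          (𝒜 , 𝒜∈ , s𝒜) = 𝔄𝔅 𝒷∈
          (A′ , A′∈ , A′S) = to (σ⇔ 𝒷) s𝒜 hS
          (A , A∈ , AA′) = 𝒰𝔄 (∈-concat⁺′ A′∈ 𝒜∈)
      in A , A∈ , ≺ᴸ-trans AA′ (≺ᴸ-trans A′S S≺T)
    from′ : σ[ _≺_ ] 𝒰 (map concat ℨ) → (σ (PU str) ∘ʳ (σ str ᵁ) ∘ʳ νU (PL str)) 𝒰 ℨ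
    from′ s =
      let (𝒱 , s𝒱 , 𝒱ℨ) = from (ᵁᴸ∘σ⇔ 𝒰 (map concat ℨ)) s
          (𝒰′ , 𝒰𝒰′ , s𝒰′) = from (σ∘ᴸᵁ⇔ 𝒰 𝒱) (to (σ⇔ 𝒱) s𝒱)
          ν𝒰 : νU (PL str) 𝒰 [ 𝒰′ ]
          ν𝒰 = subst (((_≺_ ᴸ) ᵁ) 𝒰) (sym (++-identityʳ 𝒰′)) 𝒰𝒰′
          σ𝒰′ : (σ str ᵁ) [ 𝒰′ ] [ 𝒱 ]
          σ𝒰′ = λ { (here refl) → 𝒰′ , here refl , s𝒰′ }
      in [ 𝒱 ] , ([ 𝒰′ ] , ν𝒰 , σ𝒰′) , from (σ⇔σ[≺] (PU str) ℨ) (ᵁᴸ-concat⇒σ[ᵁ]-[-] 𝒱ℨ)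

proposition3p50 :
    -- each component σ_S is a morphism of PxPos (an approximable relation)
    ((S : ProximityPoset) → let X = ProximityPoset.str S in
        IsApproximable (PU (PL X)) (PL (PU X)) (σ X))
    -- naturality:  σ_{S'} ∘ P_U P_L r = P_L P_U r ∘ σ_S
    × ((S S' : ProximityPoset) → let X = ProximityPoset.str S in let Y = ProximityPoset.str S' in
        (r : PRel X Y) → IsApproximable X Y r →
        (σ Y ∘ʳ ((r ᴸ) ᵁ)) ≐ (((r ᵁ) ᴸ) ∘ʳ σ X))
    -- K ε^T ∘ σ = ε^T K
    × ((S : ProximityPoset) → let X = ProximityPoset.str S in
        ((εU X ᴸ) ∘ʳ σ X) ≐ εU (PL X))
    -- ε^K T ∘ σ = T ε^K
    × ((S : ProximityPoset) → let X = ProximityPoset.str S in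
        (εL (PU X) ∘ʳ σ X) ≐ (εL X ᵁ))
    -- K σ ∘ σ K ∘ T ν^K = ν^K T ∘ σ
    × ((S : ProximityPoset) → let X = ProximityPoset.str S in
        ((σ X ᴸ) ∘ʳ σ (PL X) ∘ʳ (νL X ᵁ)) ≐ (νL (PU X) ∘ʳ σ X))
    -- σ T ∘ T σ ∘ ν^T K = K ν^T ∘ σ
    × ((S : ProximityPoset) → let X = ProximityPoset.str S in
        (σ (PU X) ∘ʳ (σ X ᵁ) ∘ʳ νU (PL X)) ≐ ((νU X ᴸ) ∘ʳ σ X))
proposition3p50 =
  σ-approximable , σ-natural , εUᴸ∘σ≐εU , εL∘σ≐εLᵁ , σᴸ∘σ∘νLᵁ≐νL∘σ , σ∘σᵁ∘νU≐νUᴸ∘σ
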